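{- For each $n\ge1$, the number of spanning forests of the Schreier graph $\mathcal{B}_n$ of the Basilica group is $$\left(2^{2^{\frac{n-1}{2}}}-1\right)^4\left(2^{2^{\frac{n+1}{2}}}-1\right)\prod_{i=1}^{\frac{n-1}{2}-1}\left(2^{2^i}-1\right)^{3\cdot 2^{n-2i-1}}$$ for $n$ odd, and $$\left(2^{2^{\frac{n}{2}}}-1\right)^3\prod_{i=1}^{\frac{n}{2}-1}\left(2^{2^i}-1\right)^{3\cdot 2^{n-2i-1}}$$ for $n$ even. In particular these numbers are $3$, $3^3$ and $3^5\cdot 5$ for $n=1,2,3$ respectively.
   Context: The Basilica group is generated by the automorphisms $a,b$ of the rooted binary tree defined recursively on finite binary words $w$ by $a(0w)=0\,b(w)$, $a(1w)=1w$, $b(0w)=1\,a(w)$, $b(1w)=0w$. For $n\ge1$, the Schreier graph $\mathcal{B}_n$ is the finite multigraph with vertex set $\{0,1\}^n$ having, for each vertex $u$ and each $s\in\{a,b\}$, one edge joining $u$ and $s(u)$ (a loop if $s(u)=u$). A spanning forest is a spanning subgraph (given by an edge subset, parallel edges distinct) containing no cycle; loops and pairs of parallel edges count as cycles. Empty products equal $1$. -}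

module Defs where

open import Data.Bool using (Bool; true; false)
open import Data.Nat using (ℕ; zero; suc; _+_; _*_; _∸_; _^_)
open import Data.Fin using (Fin; zero; suc; inject₁; fromℕ)
open import Data.Vec using (Vec; []; _∷_)
open import Data.Product using (Σ; _×_; _,_)
open import Data.Sum using (_⊎_)
open import Data.List using (List; length)
open import Data.List.Relation.Unary.Unique.Propositional using (Unique)
open import Data.List.Membership.Propositional using (_∈_)
open import Relation.Binary.PropositionalEquality using (_≡_)
open import Relation.Nullary using (¬_)
open import Function.Definitions using (Injective)
open import Function.Bundles using (_⇔_)

-- Vertices of B_n: binary words of length n (false = letter 0, true = letter 1).
Word : ℕ → Set
Word n = Vec Bool n

mutual
  actA : ∀ {n} → Word n → Word n
  actA [] = []
  actA (false ∷ w) = false ∷ actB w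
  actA (true ∷ w) = true ∷ w

  actB : ∀ {n} → Word n → Word n
  actB [] = []
  actB (false ∷ w) = true ∷ actA w
  actB (true ∷ w) = false ∷ w

act : ∀ {n} → Bool → Word n → Word n
act false = actA
act true = actB

-- Edges of B_n: one edge for each vertex u and generator s, joining u and s(u).
Edge : ℕ → Set
Edge n = Word n × Bool

Joins : ∀ {n} → Edge n → Word n → Word n → Set
Joins (u , s) x y = (x ≡ u × y ≡ act s u) ⊎ (x ≡ act s u × y ≡ u)

-- Edge subsets of B_n, represented as a complete binary tree of depth n whose
-- leaves record (is the a-edge selected, is the b-edge selected) at each vertex.
EdgeSet : ℕ → Set
EdgeSet zero = Bool × Bool
EdgeSet (suc n) = EdgeSet n × EdgeSet n

selected : ∀ {n} → EdgeSet n → Edge n → Bool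
selected {zero} (ea , eb) ([] , false) = ea
selected {zero} (ea , eb) ([] , true) = eb
selected {suc n} (l , r) (false ∷ w , s) = selected l (w , s)
selected {suc n} (l , r) (true ∷ w , s) = selected r (w , s)

-- F contains a cycle: m ≥ 1 pairwise distinct edges e_0 … e_{m-1} of F and
-- pairwise distinct vertices v_0 … v_{m-1}, with e_i joining v_i and v_{i+1}
-- (indices mod m, encoded by v_m = v_0).  m = 1 gives loops, m = 2 parallel edges.
HasCycle : ∀ {n} → EdgeSet n → Set
HasCycle {n} F =
  Σ ℕ λ k → let m = suc k in
  Σ (Fin m → Edge n) λ e →
  Σ (Fin (suc m) → Word n) λ v →
    (∀ i → selected F (e i) ≡ true) ×
    Injective _≡_ _≡_ e ×
    Injective _≡_ _≡_ (λ i → v (inject₁ i)) ×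
    v (fromℕ m) ≡ v zero ×
    (∀ i → Joins (e i) (v (inject₁ i)) (v (suc i)))

SpanningForest : ∀ {n} → EdgeSet n → Set
SpanningForest F = ¬ HasCycle F

NumSpanningForests : ℕ → ℕ → Set
NumSpanningForests n N =
  Σ (List (EdgeSet n)) λ L →
    Unique L × (∀ F → (F ∈ L) ⇔ SpanningForest F) × length L ≡ N

prod1 : ℕ → (ℕ → ℕ) → ℕ
prod1 zero f = 1
prod1 (suc j) f = prod1 j f * f (suc j)

M : ℕ → ℕ
M i = 2 ^ (2 ^ i) ∸ 1

-- The Schreier graph B_n is a cactus whose cycles are exactly the orbits of a and of b:
-- any two edges of one orbit form an edge cut, built recursively from the self-similarity
-- of a and b.  So an edge set is a forest iff it misses an edge of every orbit, and the
-- number of forests is the product, over all orbits, of 2^(orbit length) − 1.  Recording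
-- the forest condition level by level gives the recursion
--   W_{n+1}(x, y) = x^(2^n) W_n((1 + y)² − 1, x)
-- for the generating function W_n(x, y) of forests by unchosen a- and b-edges, and
-- y ↦ (1 + y)² − 1 maps 2^(2^j) − 1 to 2^(2^(j+1)) − 1.
module Submission where

open import Defs
open import Algebra.Bundles using (CommutativeRing)
open import Data.Bool using (Bool; true; false; not; _∧_; _xor_; if_then_else_)
open import Data.Bool.Properties using (xor-same; xor-comm; ¬-not; not-involutive; xor-∧-commutativeRing) renaming (_≟_ to _≟ᴮ_)
open import Algebra.Properties.CommutativeSemigroup (CommutativeRing.+-commutativeSemigroup xor-∧-commutativeRing)
  using () renaming (interchange to xor-interchange)
open import Data.Fin using (Fin; zero; suc; inject₁; fromℕ; toℕ)
open import Data.Fin.Properties using (toℕ-injective; toℕ-inject₁; toℕ-fromℕ; toℕ≤pred[n])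
open import Data.List using (List; []; _∷_; _++_; length; map; filter; cartesianProduct)
open import Data.List.Membership.Propositional using (_∈_)
open import Data.List.Membership.Propositional.Properties using (∈-cartesianProduct⁺; ∈-filter⁺; ∈-filter⁻)
open import Data.List.Properties using (map-++; map-∘; map-cong)
open import Data.List.Relation.Unary.All using ([]; _∷_)
open import Data.List.Relation.Unary.AllPairs using ([]; _∷_)
open import Data.List.Relation.Unary.Any using (here; there)
open import Data.List.Relation.Unary.Unique.Propositional using (Unique)
import Data.List.Relation.Unary.Unique.Propositional.Properties as Unique
open import Data.Nat using (ℕ; zero; suc; _+_; _*_; _∸_; _^_; _≤_; _<_; z≤n; s≤s)
open import Data.Nat.GeneralisedArithmetic using (iterate)
open import Data.Nat.ListAction using (sum)
open import Data.Nat.ListAction.Properties using (sum-++)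
open import Data.Nat.Properties
open import Data.Nat.Tactic.RingSolver using (solve-∀)
open import Data.Product using (∃; _×_; _,_; proj₁; proj₂)
open import Data.Sum using (_⊎_; inj₁; inj₂)
open import Data.Vec using ([]; _∷_)
open import Data.Vec.Properties using (∷-injectiveʳ; ≡-dec)
open import Function.Base using (_∘_)
open import Function.Bundles using (mk⇔)
open import Relation.Binary using (DecidableEquality; tri<; tri≈; tri>)
open import Relation.Binary.PropositionalEquality
open import Relation.Nullary using (¬_; yes; no; does; contradiction)
open import Relation.Nullary.Decidable using (dec-true; dec-false)
open import Relation.Unary using (Decidable)

iterate-suc : ∀ {A : Set} (f : A → A) x k → iterate f x (suc k) ≡ f (iterate f x k)
iterate-suc f x zero = refl
iterate-suc f x (suc k) = iterate-suc f (f x) k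

iterate-+ : ∀ {A : Set} (f : A → A) x m k → iterate f x (m + k) ≡ iterate f (iterate f x m) k
iterate-+ f x zero k = refl
iterate-+ f x (suc m) k = iterate-+ f (f x) m k

iterate-injective : ∀ {A : Set} {f : A → A} → (∀ {x y} → f x ≡ f y → x ≡ y) →
                    ∀ k {x y} → iterate f x k ≡ iterate f y k → x ≡ y
iterate-injective inj zero eq = eq
iterate-injective inj (suc k) eq = inj (iterate-injective inj k eq)

least : ∀ {P : ℕ → Set} → Decidable P → ∀ {N} → P N → ∃ λ l → P l × (∀ {j} → j < l → ¬ P j)
least P? {N} pN with P? 0
... | yes p0 = 0 , p0 , λ ()
least P? {zero} pN | no ¬p0 = contradiction pN ¬p0
least P? {suc N} pN | no ¬p0 with least (λ j → P? (suc j)) pN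
... | l , pl , below = suc l , pl , λ { {zero} _ → ¬p0 ; {suc j} (s≤s j<l) → below j<l }

∧-true : ∀ {a b} → a ∧ b ≡ true → a ≡ true × b ≡ true
∧-true {true} {true} _ = refl , refl

∧-false : ∀ {a b} → a ∧ b ≡ false → a ≡ false ⊎ b ≡ false
∧-false {false} _ = inj₁ refl
∧-false {true}  e = inj₂ e

xor-cancel-middle : ∀ a b c → (a xor b) xor (b xor c) ≡ a xor c
xor-cancel-middle false false c = refl
xor-cancel-middle false true  false = refl
xor-cancel-middle false true  true  = refl
xor-cancel-middle true  false c = refl
xor-cancel-middle true  true  false = refl
xor-cancel-middle true  true  true  = refl

xor-false : ∀ {a b} → a xor b ≡ false → a ≡ b
xor-false {false} {false} _ = refl
xor-false {true}  {true}  _ = refl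

indicator : Bool → ℕ
indicator false = 0
indicator true  = 1

indicator-∧ : ∀ a b → indicator (a ∧ b) ≡ indicator a * indicator b
indicator-∧ false b = refl
indicator-∧ true  b = sym (+-identityʳ (indicator b))

mutual
  actA-injective : ∀ {n} {x y : Word n} → actA x ≡ actA y → x ≡ y
  actA-injective {x = []}        {[]}        _  = refl
  actA-injective {x = false ∷ x} {false ∷ y} eq = cong (false ∷_) (actB-injective (∷-injectiveʳ eq))
  actA-injective {x = true ∷ x}  {true ∷ y}  eq = eq
  actA-injective {x = false ∷ x} {true ∷ y}  ()
  actA-injective {x = true ∷ x}  {false ∷ y} ()

  actB-injective : ∀ {n} {x y : Word n} → actB x ≡ actB y → x ≡ y
  actB-injective {x = []}        {[]}        _  = refl
  actB-injective {x = false ∷ x} {false ∷ y} eq = cong (false ∷_) (actA-injective (∷-injectiveʳ eq))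
  actB-injective {x = true ∷ x}  {true ∷ y}  eq = cong (true ∷_) (∷-injectiveʳ eq)
  actB-injective {x = false ∷ x} {true ∷ y}  ()
  actB-injective {x = true ∷ x}  {false ∷ y} ()

act-injective : ∀ {n} s {x y : Word n} → act s x ≡ act s y → x ≡ y
act-injective false = actA-injective
act-injective true  = actB-injective

iterate-actA-0 : ∀ {n} j (w : Word n) → iterate actA (false ∷ w) j ≡ false ∷ iterate actB w j
iterate-actA-0 zero    w = refl
iterate-actA-0 (suc j) w = iterate-actA-0 j (actB w)

iterate-actA-1 : ∀ {n} j (w : Word n) → iterate actA (true ∷ w) j ≡ true ∷ w
iterate-actA-1 zero    w = refl
iterate-actA-1 (suc j) w = iterate-actA-1 j w

iterate-actB-0 : ∀ {n} j (w : Word n) → iterate actB (false ∷ w) (j + j) ≡ false ∷ iterate actA w j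
iterate-actB-0 zero    w = refl
iterate-actB-0 (suc j) w rewrite +-suc j j = iterate-actB-0 j (actA w)

iterate-actB-1 : ∀ {n} j (w : Word n) → iterate actB (true ∷ w) (j + j) ≡ true ∷ iterate actA w j
iterate-actB-1 zero    w = refl
iterate-actB-1 (suc j) w rewrite +-suc j j = iterate-actB-1 j (actA w)

2^suc : ∀ n → 2 ^ suc n ≡ 2 ^ n + 2 ^ n
2^suc n = cong (2 ^ n +_) (+-identityʳ (2 ^ n))

act-period : ∀ n s (u : Word n) → iterate (act s) u (2 ^ n) ≡ u
act-period zero    false []          = refl
act-period zero    true  []          = refl
act-period (suc n) false (false ∷ w) rewrite 2^suc n =
  trans (iterate-actA-0 (2 ^ n + 2 ^ n) w) (cong (false ∷_) (begin
    iterate actB w (2 ^ n + 2 ^ n)                   ≡⟨ iterate-+ actB w (2 ^ n) (2 ^ n) ⟩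
    iterate actB (iterate actB w (2 ^ n)) (2 ^ n)    ≡⟨ cong (λ x → iterate actB x (2 ^ n)) (act-period n true w) ⟩
    iterate actB w (2 ^ n)                           ≡⟨ act-period n true w ⟩
    w                                                ∎))
  where open ≡-Reasoning
act-period (suc n) false (true ∷ w)  = iterate-actA-1 (2 ^ suc n) w
act-period (suc n) true  (false ∷ w) rewrite 2^suc n =
  trans (iterate-actB-0 (2 ^ n) w) (cong (false ∷_) (act-period n false w))
act-period (suc n) true  (true ∷ w)  rewrite 2^suc n =
  trans (iterate-actB-1 (2 ^ n) w) (cong (true ∷_) (act-period n false w))

actA-surjective : ∀ {n} (w : Word n) → ∃ λ z → actA z ≡ w
actA-surjective {n} w = iterate actA w (2 ^ n ∸ 1) , (begin
  actA (iterate actA w (2 ^ n ∸ 1))   ≡⟨ iterate-+ actA w (2 ^ n ∸ 1) 1 ⟨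
  iterate actA w (2 ^ n ∸ 1 + 1)     ≡⟨ cong (iterate actA w) (m∸n+n≡m (m^n>0 2 n)) ⟩
  iterate actA w (2 ^ n)             ≡⟨ act-period n false w ⟩
  w                                  ∎)
  where open ≡-Reasoning

-- Vertex labellings and full orbits

Tree : ℕ → Set
Tree zero    = Bool
Tree (suc n) = Tree n × Tree n

_!_ : ∀ {n} → Tree n → Word n → Bool
_!_ {zero}  b       _           = b
_!_ {suc n} (l , r) (false ∷ w) = l ! w
_!_ {suc n} (l , r) (true ∷ w)  = r ! w

_∧ᵀ_ : ∀ {n} → Tree n → Tree n → Tree n
_∧ᵀ_ {zero}  a       b       = a ∧ b
_∧ᵀ_ {suc n} (a , b) (c , d) = a ∧ᵀ c , b ∧ᵀ d

!-∧ᵀ : ∀ {n} (s t : Tree n) w → (s ∧ᵀ t) ! w ≡ (s ! w) ∧ (t ! w)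
!-∧ᵀ {zero}  s       t       w           = refl
!-∧ᵀ {suc n} (a , b) (c , d) (false ∷ w) = !-∧ᵀ a c w
!-∧ᵀ {suc n} (a , b) (c , d) (true ∷ w)  = !-∧ᵀ b d w

mutual
  comapA : ∀ {n} → Tree n → Tree n
  comapA {zero}  t       = t
  comapA {suc n} (l , r) = comapB l , r

  comapB : ∀ {n} → Tree n → Tree n
  comapB {zero}  t       = t
  comapB {suc n} (l , r) = comapA r , l

mutual
  !-comapA : ∀ {n} (t : Tree n) w → comapA t ! w ≡ t ! actA w
  !-comapA {zero}  t       w           = refl
  !-comapA {suc n} (l , r) (false ∷ w) = !-comapB l w
  !-comapA {suc n} (l , r) (true ∷ w)  = refl

  !-comapB : ∀ {n} (t : Tree n) w → comapB t ! w ≡ t ! actB w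
  !-comapB {zero}  t       w           = refl
  !-comapB {suc n} (l , r) (false ∷ w) = !-comapA r w
  !-comapB {suc n} (l , r) (true ∷ w)  = refl

allFalse : ∀ {n} → Tree n → Bool
allFalse {zero}  b       = not b
allFalse {suc n} (l , r) = allFalse l ∧ allFalse r

allFalse-true : ∀ {n} (t : Tree n) → allFalse t ≡ true → ∀ w → t ! w ≡ false
allFalse-true {zero}  false _ w           = refl
allFalse-true {suc n} (l , r) e (false ∷ w) = allFalse-true l (proj₁ (∧-true e)) w
allFalse-true {suc n} (l , r) e (true ∷ w)  = allFalse-true r (proj₂ (∧-true {allFalse l} e)) w

allFalse-false : ∀ {n} (t : Tree n) → allFalse t ≡ false → ∃ λ w → t ! w ≡ true
allFalse-false {zero}  true    _ = [] , refl
allFalse-false {suc n} (l , r) e with ∧-false {allFalse l} e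
... | inj₁ el = let w , p = allFalse-false l el in false ∷ w , p
... | inj₂ er = let w , p = allFalse-false r er in true ∷ w , p

-- At level n+1 the a-edges at 1w are loops, the a-orbit of 0w is the b-orbit of w behind a 0,
-- and the b-orbit of 0w runs through 0w, 1·a(w), 0·a(w), 1·a²(w), …; so it is full for
-- (β₀ , β₁) iff β₀ ∧ β₁ ∘ a holds along the a-orbit of w.
noFullOrbit : ∀ n → Tree n → Tree n → Bool
noFullOrbit zero    α         β         = not α ∧ not β
noFullOrbit (suc n) (α₀ , α₁) (β₀ , β₁) = allFalse α₁ ∧ noFullOrbit n (β₀ ∧ᵀ comapA β₁) α₀

noFullOrbit-sound : ∀ n α β → noFullOrbit n α β ≡ true →
                    ∀ (u : Word n) s → ∃ λ j → (if s then β else α) ! iterate (act s) u j ≡ false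
noFullOrbit-sound zero    false     false     _  u false = 0 , refl
noFullOrbit-sound zero    false     false     _  u true  = 0 , refl
noFullOrbit-sound (suc n) (α₀ , α₁) (β₀ , β₁) ok = orbit
  where
  loopsFree : allFalse α₁ ≡ true
  loopsFree = proj₁ (∧-true ok)

  below : noFullOrbit n (β₀ ∧ᵀ comapA β₁) α₀ ≡ true
  below = proj₂ (∧-true {allFalse α₁} ok)

  orbitB₀ : ∀ w → ∃ λ j → (β₀ , β₁) ! iterate actB (false ∷ w) j ≡ false
  orbitB₀ w with noFullOrbit-sound n _ _ below w false
  ... | j , p with β₀ ! iterate actA w j in b₀
  ... | false = j + j , trans (cong ((β₀ , β₁) !_) (iterate-actB-0 j w)) b₀
  ... | true  = suc (j + j) , (begin
    (β₀ , β₁) ! iterate actB (false ∷ w) (suc (j + j)) ≡⟨ cong ((β₀ , β₁) !_) (iterate-actB-1 j (actA w)) ⟩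
    β₁ ! iterate actA w (suc j)                        ≡⟨ cong (β₁ !_) (iterate-suc actA w j) ⟩
    β₁ ! actA (iterate actA w j)                       ≡⟨ !-comapA β₁ _ ⟨
    comapA β₁ ! iterate actA w j                       ≡⟨ subst (λ b → b ∧ _ ≡ false) b₀ (trans (sym (!-∧ᵀ β₀ _ _)) p) ⟩
    false                                              ∎)
    where open ≡-Reasoning

  orbit : ∀ u s → ∃ λ j → (if s then (β₀ , β₁) else (α₀ , α₁)) ! iterate (act s) u j ≡ false
  orbit (false ∷ w) false with noFullOrbit-sound n _ _ below w true
  ... | j , p = j , trans (cong ((α₀ , α₁) !_) (iterate-actA-0 j w)) p
  orbit (true ∷ w)  false = 0 , allFalse-true α₁ loopsFree w
  orbit (false ∷ w) true  = orbitB₀ w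
  orbit (true ∷ w)  true  = let j , p = orbitB₀ w in suc j , p

noFullOrbit-complete : ∀ n α β → noFullOrbit n α β ≡ false →
                       ∃ λ (u : Word n) → ∃ λ s → ∀ j → (if s then β else α) ! iterate (act s) u j ≡ true
noFullOrbit-complete zero    true      β         _ = [] , false , λ _ → refl
noFullOrbit-complete zero    false     true      _ = [] , true  , λ _ → refl
noFullOrbit-complete zero    false     false     ()
noFullOrbit-complete (suc n) (α₀ , α₁) (β₀ , β₁) e with ∧-false {allFalse α₁} e
... | inj₁ loop = let w , p = allFalse-false α₁ loop in
      true ∷ w , false , λ j → trans (cong ((α₀ , α₁) !_) (iterate-actA-1 j w)) p
... | inj₂ full with noFullOrbit-complete n _ _ full
...   | u , true  , h = false ∷ u , false , λ j → trans (cong ((α₀ , α₁) !_) (iterate-actA-0 j u)) (h j)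
...   | u , false , h = false ∷ u , true , fullB u h
  where
  fullB : ∀ u → (∀ i → (β₀ ∧ᵀ comapA β₁) ! iterate actA u i ≡ true) →
          ∀ j → (β₀ , β₁) ! iterate actB (false ∷ u) j ≡ true
  fullB u h zero          = proj₁ (∧-true (trans (sym (!-∧ᵀ β₀ _ u)) (h 0)))
  fullB u h (suc zero)    = trans (sym (!-comapA β₁ u)) (proj₂ (∧-true {β₀ ! u} (trans (sym (!-∧ᵀ β₀ _ u)) (h 0))))
  fullB u h (suc (suc j)) = fullB (actA u) (λ i → h (suc i)) j

edgesOf : ∀ {n} → Bool → EdgeSet n → Tree n
edgesOf {zero}  s (x , y) = if s then y else x
edgesOf {suc n} s (l , r) = edgesOf s l , edgesOf s r

!-edgesOf : ∀ {n} s (F : EdgeSet n) w → edgesOf s F ! w ≡ selected F (w , s)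
!-edgesOf {zero}  false F       []          = refl
!-edgesOf {zero}  true  F       []          = refl
!-edgesOf {suc n} s     (l , r) (false ∷ w) = !-edgesOf s l w
!-edgesOf {suc n} s     (l , r) (true ∷ w)  = !-edgesOf s r w

!-if-edgesOf : ∀ {n} s (F : EdgeSet n) w → (if s then edgesOf true F else edgesOf false F) ! w ≡ selected F (w , s)
!-if-edgesOf false F w = !-edgesOf false F w
!-if-edgesOf true  F w = !-edgesOf true  F w

isForest : ∀ {n} → EdgeSet n → Bool
isForest {n} F = noFullOrbit n (edgesOf false F) (edgesOf true F)

-- Edge cuts

crosses : ∀ {n} → (Word n → Bool) → Edge n → Bool
crosses S (u , s) = S u xor S (act s u)

crosses-Joins : ∀ {n} (S : Word n → Bool) e {x y} → Joins e x y → crosses S e ≡ S x xor S y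
crosses-Joins S (u , s) (inj₁ (refl , refl)) = refl
crosses-Joins S (u , s) (inj₂ (refl , refl)) = xor-comm (S u) (S (act s u))

_≡ᵇ_ : ∀ {n} → Word n → Word n → Bool
x ≡ᵇ y = does (≡-dec _≟ᴮ_ x y)

≡ᵇ-injective : ∀ {n} {f : Word n → Word n} → (∀ {x y} → f x ≡ f y → x ≡ y) → ∀ x y → (f x ≡ᵇ f y) ≡ (x ≡ᵇ y)
≡ᵇ-injective {f = f} inj x y with ≡-dec _≟ᴮ_ x y
... | yes refl = dec-true (≡-dec _≟ᴮ_ (f x) (f x)) refl
... | no  x≢y  = dec-false (≡-dec _≟ᴮ_ (f x) (f y)) (λ e → x≢y (inj e))

-- Allowing p = q (nothing crosses S) makes EdgeCut s an equivalence relation, so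
-- explicit cuts are needed only for consecutive edges of an orbit.
record IsEdgeCut {n} (s : Bool) (p q : Word n) (S : Word n → Bool) : Set where
  constructor isEdgeCut
  field
    cut   : ∀ w → crosses S (w , s) ≡ (w ≡ᵇ p) xor (w ≡ᵇ q)
    uncut : ∀ w → crosses S (w , not s) ≡ false

EdgeCut : ∀ {n} → Bool → Word n → Word n → Set
EdgeCut s p q = ∃ (IsEdgeCut s p q)

edgeCut-refl : ∀ {n} {s} {p : Word n} → EdgeCut s p p
edgeCut-refl {p = p} = (λ _ → false) , isEdgeCut (λ w → sym (xor-same (w ≡ᵇ p))) (λ _ → refl)

edgeCut-sym : ∀ {n} {s} {p q : Word n} → EdgeCut s p q → EdgeCut s q p
edgeCut-sym {p = p} {q} (S , isEdgeCut cut uncut) = S , isEdgeCut (λ w → trans (cut w) (xor-comm (w ≡ᵇ p) (w ≡ᵇ q))) uncut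

edgeCut-trans : ∀ {n} {s} {p q r : Word n} → EdgeCut s p q → EdgeCut s q r → EdgeCut s p r
edgeCut-trans {n} {s} {p} {q} {r} (S , isEdgeCut cutS uncutS) (T , isEdgeCut cutT uncutT) = S⊕T , isEdgeCut cut uncut
  where
  S⊕T : Word n → Bool
  S⊕T x = S x xor T x
  crosses-⊕ : ∀ e → crosses S⊕T e ≡ crosses S e xor crosses T e
  crosses-⊕ (u , t) = xor-interchange (S u) (T u) (S (act t u)) (T (act t u))
  cut : ∀ w → crosses S⊕T (w , s) ≡ (w ≡ᵇ p) xor (w ≡ᵇ r)
  cut w = trans (crosses-⊕ (w , s)) (trans (cong₂ _xor_ (cutS w) (cutT w)) (xor-cancel-middle (w ≡ᵇ p) _ _))
  uncut : ∀ w → crosses S⊕T (w , not s) ≡ false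
  uncut w = trans (crosses-⊕ (w , not s)) (cong₂ _xor_ (uncutS w) (uncutT w))

lift : ∀ {n} → (Word n → Bool) → Word (suc n) → Bool
lift S (_ ∷ w) = S w

crosses-lift-0 : ∀ {n} (S : Word n → Bool) t w → crosses (lift S) (false ∷ w , t) ≡ crosses S (w , not t)
crosses-lift-0 S false w = refl
crosses-lift-0 S true  w = refl

crosses-lift-1 : ∀ {n} (S : Word n → Bool) t w → crosses (lift S) (true ∷ w , t) ≡ false
crosses-lift-1 S false w = xor-same (S w)
crosses-lift-1 S true  w = xor-same (S w)

edgeCut-lift : ∀ {n} s {p q : Word n} → EdgeCut s p q → EdgeCut (not s) (false ∷ p) (false ∷ q)
edgeCut-lift s (S , isEdgeCut cut uncut) = lift S , isEdgeCut cut′ uncut′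
  where
  cut′ : ∀ w → crosses (lift S) (w , not s) ≡ _
  cut′ (false ∷ w) = trans (crosses-lift-0 S (not s) w)
                           (trans (cong (λ t → crosses S (w , t)) (not-involutive s)) (cut w))
  cut′ (true ∷ w)  = crosses-lift-1 S (not s) w
  uncut′ : ∀ w → crosses (lift S) (w , not (not s)) ≡ false
  uncut′ (false ∷ w) = trans (crosses-lift-0 S (not (not s)) w)
                             (trans (cong (λ t → crosses S (w , t)) (not-involutive (not s))) (uncut w))
  uncut′ (true ∷ w)  = crosses-lift-1 S (not (not s)) w

-- The only edges at the vertex 1·a(p) besides its a-loop are the b-edges at 0p and at 1·a(p).
edgeCut-flip : ∀ {n} (p : Word n) → EdgeCut true (true ∷ actA p) (false ∷ p)
edgeCut-flip p = (_≡ᵇ (true ∷ actA p)) , isEdgeCut cut uncut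
  where
  cut : ∀ w → crosses (_≡ᵇ (true ∷ actA p)) (w , true) ≡ (w ≡ᵇ (true ∷ actA p)) xor (w ≡ᵇ (false ∷ p))
  cut (false ∷ w) = ≡ᵇ-injective actA-injective w p
  cut (true ∷ w)  = refl
  uncut : ∀ w → crosses (_≡ᵇ (true ∷ actA p)) (w , false) ≡ false
  uncut (false ∷ w) = refl
  uncut (true ∷ w)  = xor-same (w ≡ᵇ actA p)

edgeCut-adjacent : ∀ n s (v : Word n) → EdgeCut s v (act s v)
edgeCut-adjacent zero    false []          = edgeCut-refl
edgeCut-adjacent zero    true  []          = edgeCut-refl
edgeCut-adjacent (suc n) false (false ∷ w) = edgeCut-lift true (edgeCut-adjacent n true w)
edgeCut-adjacent (suc n) false (true ∷ w)  = edgeCut-refl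
edgeCut-adjacent (suc n) true  (false ∷ w) = edgeCut-sym (edgeCut-flip w)
edgeCut-adjacent (suc n) true  (true ∷ w) with actA-surjective w
... | z , refl = edgeCut-trans (edgeCut-flip z) (edgeCut-lift false (edgeCut-adjacent n false z))

edgeCut-orbit : ∀ {n} s (u : Word n) j → EdgeCut s u (iterate (act s) u j)
edgeCut-orbit s u zero    = edgeCut-refl
edgeCut-orbit s u (suc j) = edgeCut-trans (edgeCut-adjacent _ s u) (edgeCut-orbit s (act s u) j)

edgeCut-elsewhere : ∀ {n} {s} {p q : Word n} {S} → IsEdgeCut s p q S →
                    ∀ e → e ≢ (p , s) → e ≢ (q , s) → crosses S e ≡ false
edgeCut-elsewhere {s = s} {p} {q} {S} (isEdgeCut cut uncut) (w , t) e≢p e≢q with t ≟ᴮ s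
... | yes refl = trans (cut w) (cong₂ _xor_ (dec-false (≡-dec _≟ᴮ_ w p) (λ w≡p → e≢p (cong (_, s) w≡p)))
                                             (dec-false (≡-dec _≟ᴮ_ w q) (λ w≡q → e≢q (cong (_, s) w≡q))))
... | no  t≢s  = subst (λ t → crosses S (w , t) ≡ false) (sym (¬-not t≢s)) (uncut w)

constant-along : ∀ {A : Set} k (f : Fin (suc k) → A) → (∀ (i : Fin k) → f (inject₁ i) ≡ f (suc i)) → f zero ≡ f (fromℕ k)
constant-along zero    f step = refl
constant-along (suc k) f step = trans (step zero) (constant-along k (λ i → f (suc i)) (λ i → step (suc i)))

-- A closed walk crosses a vertex set an even number of times.
closedWalk-crosses : ∀ {n} k (S : Word n → Bool) (e : Fin (suc k) → Edge n) (v : Fin (suc (suc k)) → Word n) →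
                     v (fromℕ (suc k)) ≡ v zero → (∀ i → Joins (e i) (v (inject₁ i)) (v (suc i))) →
                     (∀ i → crosses S (e (suc i)) ≡ false) → crosses S (e zero) ≡ false
closedWalk-crosses k S e v closed joins rest = begin
  crosses S (e zero)                  ≡⟨ crosses-Joins S (e zero) (joins zero) ⟩
  S (v zero) xor S (v (suc zero))     ≡⟨ cong (S (v zero) xor_) (constant-along k (λ i → S (v (suc i))) step) ⟩
  S (v zero) xor S (v (fromℕ (suc k))) ≡⟨ cong (λ x → S (v zero) xor S x) closed ⟩
  S (v zero) xor S (v zero)           ≡⟨ xor-same (S (v zero)) ⟩
  false                               ∎
  where
  open ≡-Reasoning
  step : ∀ i → S (v (suc (inject₁ i))) ≡ S (v (suc (suc i)))
  step i = xor-false (trans (sym (crosses-Joins S (e (suc i)) (joins (suc i)))) (rest i))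

-- Cut the orbit cycle of the first cycle edge at that edge and at an unchosen edge of the
-- same orbit: the cycle would have to cross this cut exactly once.
isForest-sound : ∀ {n} (F : EdgeSet n) → isForest F ≡ true → SpanningForest F
isForest-sound {n} F ok (k , e , v , chosen , e-injective , _ , closed , joins) =
  true≢false (trans (sym crossed) (closedWalk-crosses k S e v closed joins others))
  where
  true≢false : true ≢ false
  true≢false ()
  u : Word n
  u = proj₁ (e zero)
  s : Bool
  s = proj₂ (e zero)
  j : ℕ
  j = proj₁ (noFullOrbit-sound n _ _ ok u s)
  u′ : Word n
  u′ = iterate (act s) u j
  unchosen : selected F (u′ , s) ≡ false
  unchosen = trans (sym (!-if-edgesOf s F u′)) (proj₂ (noFullOrbit-sound n _ _ ok u s))
  S : Word n → Bool
  S = proj₁ (edgeCut-orbit s u j)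
  cut : IsEdgeCut s u u′ S
  cut = proj₂ (edgeCut-orbit s u j)
  chosen≢unchosen : ∀ {e′} → selected F e′ ≡ true → e′ ≢ (u′ , s)
  chosen≢unchosen sel refl = true≢false (trans (sym sel) unchosen)
  crossed : crosses S (e zero) ≡ true
  crossed = trans (IsEdgeCut.cut cut u)
              (cong₂ _xor_ (dec-true (≡-dec _≟ᴮ_ u u) refl)
                           (dec-false (≡-dec _≟ᴮ_ u u′) (λ u≡u′ → chosen≢unchosen (chosen zero) (cong (_, s) u≡u′))))
  others : ∀ i → crosses S (e (suc i)) ≡ false
  others i = edgeCut-elsewhere cut (e (suc i)) (λ eq → 0≢suc (e-injective (sym eq))) (chosen≢unchosen (chosen (suc i)))
    where
    0≢suc : zero ≢ suc i
    0≢suc ()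

firstReturn : ∀ {A : Set} → DecidableEquality A → ∀ {f : A → A} → (∀ {x y} → f x ≡ f y → x ≡ y) →
              ∀ {x} N → iterate f x (suc N) ≡ x →
              ∃ λ l → iterate f x (suc l) ≡ x × (∀ {p q} → p ≤ l → q ≤ l → iterate f x p ≡ iterate f x q → p ≡ q)
firstReturn {A} _≟_ {f} f-injective {x} N returns = l , returnsAt-l , orbit-injective
  where
  orbit : ℕ → A
  orbit = iterate f x

  least-return : ∃ λ l → orbit (suc l) ≡ x × (∀ {d} → d < l → orbit (suc d) ≢ x)
  least-return = least (λ j → orbit (suc j) ≟ x) {N} returns

  l : ℕ
  l = proj₁ least-return

  returnsAt-l : orbit (suc l) ≡ x
  returnsAt-l = proj₁ (proj₂ least-return)

  noRepeat : ∀ p d → p + suc d ≤ l → orbit p ≢ orbit (p + suc d)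
  noRepeat p d le eq = proj₂ (proj₂ least-return) (≤-trans (m≤n+m (suc d) p) le)
    (sym (iterate-injective f-injective p (begin
      orbit p                     ≡⟨ eq ⟩
      orbit (p + suc d)           ≡⟨ cong orbit (+-comm p (suc d)) ⟩
      orbit (suc d + p)           ≡⟨ iterate-+ f x (suc d) p ⟩
      iterate f (orbit (suc d)) p ∎)))
    where open ≡-Reasoning

  orbit-injective : ∀ {p q} → p ≤ l → q ≤ l → orbit p ≡ orbit q → p ≡ q
  orbit-injective {p} {q} p≤l q≤l eq with <-cmp p q
  ... | tri≈ _ p≡q _ = p≡q
  ... | tri< p<q _ _ = let d , p+d≡q = m≤n⇒∃[o]m+o≡n p<q
                           q≡ = trans (sym p+d≡q) (sym (+-suc p d)) in
                       contradiction (trans eq (cong orbit q≡)) (noRepeat p d (subst (_≤ l) q≡ q≤l))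
  ... | tri> _ _ q<p = let d , q+d≡p = m≤n⇒∃[o]m+o≡n q<p
                           p≡ = trans (sym q+d≡p) (sym (+-suc q d)) in
                       contradiction (trans (sym eq) (cong orbit p≡)) (noRepeat q d (subst (_≤ l) p≡ p≤l))

fullOrbit-cycle : ∀ {n} (F : EdgeSet n) (u : Word n) s →
                  (∀ j → selected F (iterate (act s) u j , s) ≡ true) → HasCycle F
fullOrbit-cycle {n} F u s full = l , e , v , (λ i → full (toℕ i)) , e-injective , v-injective , closed , joins
  where
  orbit : ℕ → Word n
  orbit = iterate (act s) u

  period : orbit (suc (2 ^ n ∸ 1)) ≡ u
  period = trans (cong orbit (trans (+-comm 1 _) (m∸n+n≡m (m^n>0 2 n)))) (act-period n s u)

  cycle : ∃ λ l → orbit (suc l) ≡ u × (∀ {p q} → p ≤ l → q ≤ l → orbit p ≡ orbit q → p ≡ q)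
  cycle = firstReturn (≡-dec _≟ᴮ_) (act-injective s) (2 ^ n ∸ 1) period

  l : ℕ
  l = proj₁ cycle

  returnsAt-l : orbit (suc l) ≡ u
  returnsAt-l = proj₁ (proj₂ cycle)

  orbit-injective : ∀ {p q} → p ≤ l → q ≤ l → orbit p ≡ orbit q → p ≡ q
  orbit-injective = proj₂ (proj₂ cycle)

  e : Fin (suc l) → Edge n
  e i = orbit (toℕ i) , s

  v : Fin (suc (suc l)) → Word n
  v i = orbit (toℕ i)

  v-inject₁ : ∀ i → v (inject₁ i) ≡ orbit (toℕ i)
  v-inject₁ i = cong orbit (toℕ-inject₁ i)

  e-injective : ∀ {i j} → e i ≡ e j → i ≡ j
  e-injective {i} {j} eq = toℕ-injective (orbit-injective (toℕ≤pred[n] i) (toℕ≤pred[n] j) (cong proj₁ eq))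

  v-injective : ∀ {i j} → v (inject₁ i) ≡ v (inject₁ j) → i ≡ j
  v-injective {i} {j} eq = toℕ-injective (orbit-injective (toℕ≤pred[n] i) (toℕ≤pred[n] j)
                             (trans (sym (v-inject₁ i)) (trans eq (v-inject₁ j))))

  closed : v (fromℕ (suc l)) ≡ v zero
  closed = trans (cong orbit (toℕ-fromℕ (suc l))) returnsAt-l

  joins : ∀ i → Joins (e i) (v (inject₁ i)) (v (suc i))
  joins i = inj₁ (v-inject₁ i , iterate-suc (act s) u (toℕ i))

isForest-complete : ∀ {n} (F : EdgeSet n) → SpanningForest F → isForest F ≡ true
isForest-complete {n} F acyclic with isForest F in eq
... | true  = refl
... | false = let u , s , full = noFullOrbit-complete n _ _ eq in
  contradiction (fullOrbit-cycle F u s (λ j → trans (sym (!-if-edgesOf s F _)) (full j))) acyclic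

-- The generating function of forests

sumTree : ∀ n → (Tree n → ℕ) → ℕ
sumTree zero    f = f false + f true
sumTree (suc n) f = sumTree n (λ l → sumTree n (λ r → f (l , r)))

sumTree-cong : ∀ n {f g : Tree n → ℕ} → (∀ t → f t ≡ g t) → sumTree n f ≡ sumTree n g
sumTree-cong zero    f≗g = cong₂ _+_ (f≗g false) (f≗g true)
sumTree-cong (suc n) f≗g = sumTree-cong n (λ l → sumTree-cong n (λ r → f≗g (l , r)))

sumTree-+ : ∀ n (f g : Tree n → ℕ) → sumTree n (λ t → f t + g t) ≡ sumTree n f + sumTree n g
sumTree-+ zero    f g = +-+-interchange (f false) (f true) (g false) (g true)
  where
  +-+-interchange : ∀ a b c d → (a + c) + (b + d) ≡ (a + b) + (c + d)
  +-+-interchange = solve-∀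
sumTree-+ (suc n) f g = trans (sumTree-cong n (λ l → sumTree-+ n (λ r → f (l , r)) (λ r → g (l , r))))
                              (sumTree-+ n (λ l → sumTree n (λ r → f (l , r))) (λ l → sumTree n (λ r → g (l , r))))

sumTree-*ˡ : ∀ n c (f : Tree n → ℕ) → sumTree n (λ t → c * f t) ≡ c * sumTree n f
sumTree-*ˡ zero    c f = sym (*-distribˡ-+ c (f false) (f true))
sumTree-*ˡ (suc n) c f = trans (sumTree-cong n (λ l → sumTree-*ˡ n c (λ r → f (l , r)))) (sumTree-*ˡ n c _)

sumTree-*ʳ : ∀ n c (f : Tree n → ℕ) → sumTree n (λ t → f t * c) ≡ sumTree n f * c
sumTree-*ʳ n c f = trans (sumTree-cong n (λ t → *-comm (f t) c)) (trans (sumTree-*ˡ n c f) (*-comm c _))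

sumTree-swap : ∀ n m (f : Tree n → Tree m → ℕ) →
               sumTree n (λ s → sumTree m (λ t → f s t)) ≡ sumTree m (λ t → sumTree n (λ s → f s t))
sumTree-swap zero    m f = sym (sumTree-+ m (f false) (f true))
sumTree-swap (suc n) m f = trans (sumTree-cong n (λ l → sumTree-swap n m (λ r t → f (l , r) t)))
                                 (sumTree-swap n m (λ l t → sumTree n (λ r → f (l , r) t)))

mutual
  sumTree-comapA : ∀ n (f : Tree n → ℕ) → sumTree n (λ t → f (comapA t)) ≡ sumTree n f
  sumTree-comapA zero    f = refl
  sumTree-comapA (suc n) f = sumTree-comapB n (λ l → sumTree n (λ r → f (l , r)))

  sumTree-comapB : ∀ n (f : Tree n → ℕ) → sumTree n (λ t → f (comapB t)) ≡ sumTree n f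
  sumTree-comapB zero    f = refl
  sumTree-comapB (suc n) f = trans (sumTree-cong n (λ l → sumTree-comapA n (λ r → f (r , l))))
                                   (sumTree-swap n n (λ l r → f (r , l)))

weight : ∀ {n} → ℕ → Tree n → ℕ
weight {zero}  x false   = x
weight {zero}  x true    = 1
weight {suc n} x (l , r) = weight x l * weight x r

weight-1 : ∀ {n} (t : Tree n) → weight 1 t ≡ 1
weight-1 {zero}  false   = refl
weight-1 {zero}  true    = refl
weight-1 {suc n} (l , r) = cong₂ _*_ (weight-1 l) (weight-1 r)

mutual
  weight-comapA : ∀ {n} x (t : Tree n) → weight x (comapA t) ≡ weight x t
  weight-comapA {zero}  x t       = refl
  weight-comapA {suc n} x (l , r) = cong (_* weight x r) (weight-comapB x l)

  weight-comapB : ∀ {n} x (t : Tree n) → weight x (comapB t) ≡ weight x t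
  weight-comapB {zero}  x t       = refl
  weight-comapB {suc n} x (l , r) = trans (cong (_* weight x l) (weight-comapA x r)) (*-comm (weight x r) (weight x l))

sumTree-allFalse : ∀ n x → sumTree n (λ t → indicator (allFalse t) * weight x t) ≡ x ^ (2 ^ n)
sumTree-allFalse zero    x = only-false x
  where
  only-false : ∀ x → 1 * x + 0 * 1 ≡ x * 1
  only-false = solve-∀
sumTree-allFalse (suc n) x = begin
  sumTree n (λ l → sumTree n (λ r → indicator (allFalse l ∧ allFalse r) * (weight x l * weight x r)))
    ≡⟨ sumTree-cong n (λ l → sumTree-cong n (λ r → split (allFalse l) (allFalse r) (weight x l) (weight x r))) ⟩
  sumTree n (λ l → sumTree n (λ r → c l * c r))
    ≡⟨ sumTree-cong n (λ l → sumTree-*ˡ n (c l) c) ⟩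
  sumTree n (λ l → c l * sumTree n c)
    ≡⟨ sumTree-*ʳ n _ c ⟩
  sumTree n c * sumTree n c
    ≡⟨ cong₂ _*_ (sumTree-allFalse n x) (sumTree-allFalse n x) ⟩
  x ^ (2 ^ n) * x ^ (2 ^ n)
    ≡⟨ ^-distribˡ-+-* x (2 ^ n) (2 ^ n) ⟨
  x ^ (2 ^ n + 2 ^ n)
    ≡⟨ cong (x ^_) (2^suc n) ⟨
  x ^ (2 ^ suc n) ∎
  where
  open ≡-Reasoning
  c : Tree n → ℕ
  c t = indicator (allFalse t) * weight x t
  split : ∀ a b p q → indicator (a ∧ b) * (p * q) ≡ (indicator a * p) * (indicator b * q)
  split a b p q rewrite indicator-∧ a b = regroup (indicator a) (indicator b) p q
    where
    regroup : ∀ i j p q → (i * j) * (p * q) ≡ (i * p) * (j * q)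
    regroup = solve-∀

-- (1 + y)² − 1: the weight of the three labellings of a pair of vertices whose conjunction is false
pairWeight : ℕ → ℕ
pairWeight y = y * y + y + y

sumTree-∧ᵀ : ∀ n y (H : Tree n → ℕ) →
             sumTree n (λ b₀ → sumTree n (λ b₁ → H (b₀ ∧ᵀ b₁) * (weight y b₀ * weight y b₁)))
             ≡ sumTree n (λ γ → H γ * weight (pairWeight y) γ)
sumTree-∧ᵀ zero    y H = expand (H false) (H true) y
  where
  expand : ∀ a b y → (a * (y * y) + a * (y * 1)) + (a * (1 * y) + b * (1 * 1)) ≡ a * (y * y + y + y) + b * 1
  expand = solve-∀
sumTree-∧ᵀ (suc n) y H =
  trans (sumTree-cong n (λ a₀ → sumTree-swap n n (λ a₁ b₀ → sumTree n (λ b₁ →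
           H (a₀ ∧ᵀ b₀ , a₁ ∧ᵀ b₁) * ((weight y a₀ * weight y a₁) * (weight y b₀ * weight y b₁))))))
  (trans (sumTree-cong n (λ a₀ → sumTree-cong n (λ b₀ → left a₀ b₀)))
  (trans (sumTree-∧ᵀ n y Φ)
         (sumTree-cong n (λ g₀ → trans (sym (sumTree-*ʳ n (weight (pairWeight y) g₀) (λ g₁ → H (g₀ , g₁) * weight (pairWeight y) g₁)))
                                       (sumTree-cong n (λ g₁ → reassoc (H (g₀ , g₁)) _ _))))))
  where
  Φ : Tree n → ℕ
  Φ g₀ = sumTree n (λ g₁ → H (g₀ , g₁) * weight (pairWeight y) g₁)
  regroup : ∀ h p q r s → h * ((p * q) * (r * s)) ≡ (p * r) * (h * (q * s))
  regroup = solve-∀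
  reassoc : ∀ h p q → h * q * p ≡ h * (p * q)
  reassoc = solve-∀
  left : ∀ a₀ b₀ → sumTree n (λ a₁ → sumTree n (λ b₁ → H (a₀ ∧ᵀ b₀ , a₁ ∧ᵀ b₁) * ((weight y a₀ * weight y a₁) * (weight y b₀ * weight y b₁))))
                   ≡ Φ (a₀ ∧ᵀ b₀) * (weight y a₀ * weight y b₀)
  left a₀ b₀ =
    trans (sumTree-cong n (λ a₁ → sumTree-cong n (λ b₁ → regroup (H (a₀ ∧ᵀ b₀ , a₁ ∧ᵀ b₁)) (weight y a₀) (weight y a₁) (weight y b₀) (weight y b₁))))
    (trans (sumTree-cong n (λ a₁ → sumTree-*ˡ n (weight y a₀ * weight y b₀) _))
    (trans (sumTree-*ˡ n (weight y a₀ * weight y b₀) _)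
    (trans (cong (weight y a₀ * weight y b₀ *_) (sumTree-∧ᵀ n y (λ g₁ → H (a₀ ∧ᵀ b₀ , g₁))))
           (*-comm (weight y a₀ * weight y b₀) (Φ (a₀ ∧ᵀ b₀))))))

sumTree-∧ᵀ-comapA : ∀ n y (H : Tree n → ℕ) →
                    sumTree n (λ b₀ → sumTree n (λ b₁ → H (b₀ ∧ᵀ comapA b₁) * (weight y b₀ * weight y b₁)))
                    ≡ sumTree n (λ γ → H γ * weight (pairWeight y) γ)
sumTree-∧ᵀ-comapA n y H = trans (sumTree-cong n reindex) (sumTree-∧ᵀ n y H)
  where
  reindex : ∀ b₀ → sumTree n (λ b₁ → H (b₀ ∧ᵀ comapA b₁) * (weight y b₀ * weight y b₁))
                   ≡ sumTree n (λ b₁ → H (b₀ ∧ᵀ b₁) * (weight y b₀ * weight y b₁))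
  reindex b₀ = trans (sumTree-cong n (λ b₁ → cong (λ w → H (b₀ ∧ᵀ comapA b₁) * (weight y b₀ * w)) (sym (weight-comapA y b₁))))
                     (sumTree-comapA n (λ t → H (b₀ ∧ᵀ t) * (weight y b₀ * weight y t)))

weightedForests : ℕ → ℕ → ℕ → ℕ
weightedForests n x y = sumTree n (λ α → sumTree n (λ β → indicator (noFullOrbit n α β) * (weight x α * weight y β)))

weightedForests-zero : ∀ x y → weightedForests 0 x y ≡ x * y
weightedForests-zero x y = only-α=β=false x y
  where
  only-α=β=false : ∀ x y → (1 * (x * y) + 0 * (x * 1)) + (0 * (1 * y) + 0 * (1 * 1)) ≡ x * y
  only-α=β=false = solve-∀

weightedForests-suc : ∀ n x y → weightedForests (suc n) x y ≡ x ^ (2 ^ n) * weightedForests n (pairWeight y) x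
weightedForests-suc n x y = begin
  weightedForests (suc n) x y
    ≡⟨ sumTree-cong n (λ a₀ → sumTree-cong n (λ a₁ → sumTree-cong n (λ b₀ → sumTree-cong n (λ b₁ →
         split (allFalse a₁) (noFullOrbit n (b₀ ∧ᵀ comapA b₁) a₀) (weight x a₀) (weight x a₁) (weight y b₀) (weight y b₁))))) ⟩
  sumTree n (λ a₀ → sumTree n (λ a₁ → sumTree n (λ b₀ → sumTree n (λ b₁ → loops a₁ * inner a₀ b₀ b₁))))
    ≡⟨ sumTree-cong n (λ a₀ → sumTree-cong n (λ a₁ →
         trans (sumTree-cong n (λ b₀ → sumTree-*ˡ n (loops a₁) _)) (sumTree-*ˡ n (loops a₁) _))) ⟩
  sumTree n (λ a₀ → sumTree n (λ a₁ → loops a₁ * Inner a₀))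
    ≡⟨ sumTree-cong n (λ a₀ → trans (sumTree-*ʳ n _ loops) (cong (_* Inner a₀) (sumTree-allFalse n x))) ⟩
  sumTree n (λ a₀ → x ^ (2 ^ n) * Inner a₀)
    ≡⟨ sumTree-*ˡ n (x ^ (2 ^ n)) Inner ⟩
  x ^ (2 ^ n) * sumTree n Inner
    ≡⟨ cong (x ^ (2 ^ n) *_) (sumTree-cong n Inner-pairWeight) ⟩
  x ^ (2 ^ n) * sumTree n (λ a₀ → sumTree n (λ γ → weight x a₀ * (indicator (noFullOrbit n γ a₀) * weight (pairWeight y) γ)))
    ≡⟨ cong (x ^ (2 ^ n) *_) (trans (sumTree-swap n n _) (sumTree-cong n λ γ → sumTree-cong n λ a₀ →
         reorder (indicator (noFullOrbit n γ a₀)) (weight (pairWeight y) γ) (weight x a₀))) ⟩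
  x ^ (2 ^ n) * weightedForests n (pairWeight y) x ∎
  where
  open ≡-Reasoning
  loops : Tree n → ℕ
  loops a₁ = indicator (allFalse a₁) * weight x a₁
  inner : Tree n → Tree n → Tree n → ℕ
  inner a₀ b₀ b₁ = weight x a₀ * (indicator (noFullOrbit n (b₀ ∧ᵀ comapA b₁) a₀) * (weight y b₀ * weight y b₁))
  Inner : Tree n → ℕ
  Inner a₀ = sumTree n (λ b₀ → sumTree n (λ b₁ → inner a₀ b₀ b₁))
  split : ∀ a b p q r s → indicator (a ∧ b) * ((p * q) * (r * s)) ≡ (indicator a * q) * (p * (indicator b * (r * s)))
  split a b p q r s rewrite indicator-∧ a b = regroup (indicator a) (indicator b) p q r s
    where
    regroup : ∀ i j p q r s → (i * j) * ((p * q) * (r * s)) ≡ (i * q) * (p * (j * (r * s)))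
    regroup = solve-∀
  reorder : ∀ i g p → p * (i * g) ≡ i * (g * p)
  reorder = solve-∀
  Inner-pairWeight : ∀ a₀ → Inner a₀ ≡ sumTree n (λ γ → weight x a₀ * (indicator (noFullOrbit n γ a₀) * weight (pairWeight y) γ))
  Inner-pairWeight a₀ = begin
    Inner a₀
      ≡⟨ trans (sumTree-cong n (λ b₀ → sumTree-*ˡ n (weight x a₀) _)) (sumTree-*ˡ n (weight x a₀) _) ⟩
    weight x a₀ * sumTree n (λ b₀ → sumTree n (λ b₁ → indicator (noFullOrbit n (b₀ ∧ᵀ comapA b₁) a₀) * (weight y b₀ * weight y b₁)))
      ≡⟨ cong (weight x a₀ *_) (sumTree-∧ᵀ-comapA n y (λ γ → indicator (noFullOrbit n γ a₀))) ⟩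
    weight x a₀ * sumTree n (λ γ → indicator (noFullOrbit n γ a₀) * weight (pairWeight y) γ)
      ≡⟨ sumTree-*ˡ n (weight x a₀) _ ⟨
    sumTree n (λ γ → weight x a₀ * (indicator (noFullOrbit n γ a₀) * weight (pairWeight y) γ)) ∎

mutual
  aFactor : ℕ → (ℕ → ℕ) → ℕ
  aFactor zero    f = f 0
  aFactor (suc n) f = f 0 ^ 2 ^ n * bFactor n f

  bFactor : ℕ → (ℕ → ℕ) → ℕ
  bFactor zero    f = f 0
  bFactor (suc n) f = aFactor n (f ∘ suc)

IsPairWeightChain : (ℕ → ℕ) → Set
IsPairWeightChain f = ∀ k → pairWeight (f k) ≡ f (suc k)

weightedForests-factors : ∀ n f g → IsPairWeightChain f → IsPairWeightChain g →
                          weightedForests n (f 0) (g 0) ≡ aFactor n f * bFactor n g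
weightedForests-factors zero    f g _ _ = weightedForests-zero (f 0) (g 0)
weightedForests-factors (suc n) f g chain-f chain-g = begin
  weightedForests (suc n) (f 0) (g 0)                   ≡⟨ weightedForests-suc n (f 0) (g 0) ⟩
  f 0 ^ 2 ^ n * weightedForests n (pairWeight (g 0)) (f 0) ≡⟨ cong (λ y → f 0 ^ 2 ^ n * weightedForests n y (f 0)) (chain-g 0) ⟩
  f 0 ^ 2 ^ n * weightedForests n (g 1) (f 0)           ≡⟨ cong (f 0 ^ 2 ^ n *_) (weightedForests-factors n (g ∘ suc) f (chain-g ∘ suc) chain-f) ⟩
  f 0 ^ 2 ^ n * (aFactor n (g ∘ suc) * bFactor n f)     ≡⟨ rearrange (f 0 ^ 2 ^ n) _ _ ⟩
  (f 0 ^ 2 ^ n * bFactor n f) * aFactor n (g ∘ suc)     ∎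
  where
  open ≡-Reasoning
  rearrange : ∀ a b c → a * (b * c) ≡ (a * c) * b
  rearrange = solve-∀

M-isPairWeightChain : IsPairWeightChain M
M-isPairWeightChain j = sym (begin
  M (suc j)                          ≡⟨ cong (λ e → 2 ^ e ∸ 1) (2^suc j) ⟩
  2 ^ (2 ^ j + 2 ^ j) ∸ 1            ≡⟨ cong (_∸ 1) (^-distribˡ-+-* 2 (2 ^ j) (2 ^ j)) ⟩
  2 ^ 2 ^ j * 2 ^ 2 ^ j ∸ 1          ≡⟨ cong (λ x → x * x ∸ 1) (sym suc-M) ⟩
  suc (M j) * suc (M j) ∸ 1          ≡⟨ expand (M j) ⟩
  pairWeight (M j)                   ∎)
  where
  open ≡-Reasoning
  suc-M : suc (M j) ≡ 2 ^ 2 ^ j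
  suc-M = trans (+-comm 1 _) (m∸n+n≡m (m^n>0 2 (2 ^ j)))
  expand : ∀ q → q + q * suc q ≡ q * q + q + q
  expand = solve-∀

bools : List Bool
bools = false ∷ true ∷ []

allEdgeSets : ∀ n → List (EdgeSet n)
allEdgeSets zero    = cartesianProduct bools bools
allEdgeSets (suc n) = cartesianProduct (allEdgeSets n) (allEdgeSets n)

allEdgeSets-unique : ∀ n → Unique (allEdgeSets n)
allEdgeSets-unique zero    = Unique.cartesianProduct⁺ bools-unique bools-unique
  where
  bools-unique : Unique bools
  bools-unique = ((λ ()) ∷ []) ∷ ([] ∷ [])
allEdgeSets-unique (suc n) = Unique.cartesianProduct⁺ (allEdgeSets-unique n) (allEdgeSets-unique n)

∈-allEdgeSets : ∀ n (F : EdgeSet n) → F ∈ allEdgeSets n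
∈-allEdgeSets zero    (a , b) = ∈-cartesianProduct⁺ (∈-bools a) (∈-bools b)
  where
  ∈-bools : ∀ b → b ∈ bools
  ∈-bools false = here refl
  ∈-bools true  = there (here refl)
∈-allEdgeSets (suc n) (l , r) = ∈-cartesianProduct⁺ (∈-allEdgeSets n l) (∈-allEdgeSets n r)

sum-cartesianProduct : ∀ {A B : Set} (g : A × B → ℕ) xs ys →
                       sum (map g (cartesianProduct xs ys)) ≡ sum (map (λ x → sum (map (λ y → g (x , y)) ys)) xs)
sum-cartesianProduct g []       ys = refl
sum-cartesianProduct g (x ∷ xs) ys = begin
  sum (map g (map (x ,_) ys ++ cartesianProduct xs ys))            ≡⟨ cong sum (map-++ g (map (x ,_) ys) _) ⟩
  sum (map g (map (x ,_) ys) ++ map g (cartesianProduct xs ys))    ≡⟨ sum-++ (map g (map (x ,_) ys)) _ ⟩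
  sum (map g (map (x ,_) ys)) + sum (map g (cartesianProduct xs ys)) ≡⟨ cong₂ _+_ (cong sum (sym (map-∘ ys))) (sum-cartesianProduct g xs ys) ⟩
  sum (map (λ y → g (x , y)) ys) + sum (map (λ x → sum (map (λ y → g (x , y)) ys)) xs) ∎
  where
  open ≡-Reasoning

sum-allEdgeSets : ∀ n (G : Tree n → Tree n → ℕ) →
                  sum (map (λ F → G (edgesOf false F) (edgesOf true F)) (allEdgeSets n))
                  ≡ sumTree n (λ α → sumTree n (λ β → G α β))
sum-allEdgeSets zero    G = regroup (G false false) (G false true) (G true false) (G true true)
  where
  regroup : ∀ a b c d → a + (b + (c + (d + 0))) ≡ (a + b) + (c + d)
  regroup = solve-∀
sum-allEdgeSets (suc n) G = begin
  sum (map (λ F → G (edgesOf false F) (edgesOf true F)) (cartesianProduct (allEdgeSets n) (allEdgeSets n)))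
    ≡⟨ sum-cartesianProduct _ (allEdgeSets n) (allEdgeSets n) ⟩
  sum (map (λ l → sum (map (λ r → G (edgesOf false l , edgesOf false r) (edgesOf true l , edgesOf true r)) (allEdgeSets n))) (allEdgeSets n))
    ≡⟨ cong sum (map-cong (λ l → sum-allEdgeSets n (λ α₂ β₂ → G (edgesOf false l , α₂) (edgesOf true l , β₂))) (allEdgeSets n)) ⟩
  sum (map (λ l → sumTree n (λ α₂ → sumTree n (λ β₂ → G (edgesOf false l , α₂) (edgesOf true l , β₂)))) (allEdgeSets n))
    ≡⟨ sum-allEdgeSets n (λ α₁ β₁ → sumTree n (λ α₂ → sumTree n (λ β₂ → G (α₁ , α₂) (β₁ , β₂)))) ⟩
  sumTree n (λ α₁ → sumTree n (λ β₁ → sumTree n (λ α₂ → sumTree n (λ β₂ → G (α₁ , α₂) (β₁ , β₂)))))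
    ≡⟨ sumTree-cong n (λ α₁ → sumTree-swap n n (λ β₁ α₂ → sumTree n (λ β₂ → G (α₁ , α₂) (β₁ , β₂)))) ⟩
  sumTree n (λ α₁ → sumTree n (λ α₂ → sumTree n (λ β₁ → sumTree n (λ β₂ → G (α₁ , α₂) (β₁ , β₂))))) ∎
  where open ≡-Reasoning

length-filter-true : ∀ {A : Set} (p : A → Bool) xs →
                     length (filter (λ x → p x ≟ᴮ true) xs) ≡ sum (map (indicator ∘ p) xs)
length-filter-true p []       = refl
length-filter-true p (x ∷ xs) with p x
... | true  = cong suc (length-filter-true p xs)
... | false = length-filter-true p xs

numSpanningForests : ∀ n → NumSpanningForests n (aFactor n M * bFactor n M)
numSpanningForests n = forests , Unique.filter⁺ forest? (allEdgeSets-unique n) , (λ F → mk⇔ (sound F) (complete F)) , count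
  where
  forest? : Decidable (λ (F : EdgeSet n) → isForest F ≡ true)
  forest? F = isForest F ≟ᴮ true
  forests : List (EdgeSet n)
  forests = filter forest? (allEdgeSets n)
  sound : ∀ F → F ∈ forests → SpanningForest F
  sound F F∈ = isForest-sound F (proj₂ (∈-filter⁻ forest? {xs = allEdgeSets n} F∈))
  complete : ∀ F → SpanningForest F → F ∈ forests
  complete F acyclic = ∈-filter⁺ forest? (∈-allEdgeSets n F) (isForest-complete F acyclic)
  count : length forests ≡ aFactor n M * bFactor n M
  count = begin
    length forests
      ≡⟨ length-filter-true isForest (allEdgeSets n) ⟩
    sum (map (indicator ∘ isForest) (allEdgeSets n))
      ≡⟨ sum-allEdgeSets n (λ α β → indicator (noFullOrbit n α β)) ⟩
    sumTree n (λ α → sumTree n (λ β → indicator (noFullOrbit n α β)))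
      ≡⟨ sumTree-cong n (λ α → sumTree-cong n (λ β →
           sym (trans (cong (indicator (noFullOrbit n α β) *_) (cong₂ _*_ (weight-1 α) (weight-1 β)))
                      (*-identityʳ _)))) ⟩
    weightedForests n 1 1
      ≡⟨ weightedForests-factors n M M M-isPairWeightChain M-isPairWeightChain ⟩
    aFactor n M * bFactor n M ∎
    where open ≡-Reasoning

-- The closed form

prod0 : ℕ → (ℕ → ℕ) → ℕ
prod0 zero    f = 1
prod0 (suc m) f = f 0 * prod0 m (f ∘ suc)

prod0-cong : ∀ m {f g : ℕ → ℕ} → (∀ {k} → k < m → f k ≡ g k) → prod0 m f ≡ prod0 m g
prod0-cong zero    f≗g = refl
prod0-cong (suc m) f≗g = cong₂ _*_ (f≗g (s≤s z≤n)) (prod0-cong m (λ k<m → f≗g (s≤s k<m)))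

prod0-snoc : ∀ m f → prod0 (suc m) f ≡ prod0 m f * f m
prod0-snoc zero    f = trans (*-identityʳ (f 0)) (sym (*-identityˡ (f 0)))
prod0-snoc (suc m) f = trans (cong (f 0 *_) (prod0-snoc m (f ∘ suc))) (sym (*-assoc (f 0) _ _))

prod0-^-+ : ∀ m (x a b : ℕ → ℕ) → prod0 m (λ k → x k ^ a k) * prod0 m (λ k → x k ^ b k) ≡ prod0 m (λ k → x k ^ (a k + b k))
prod0-^-+ zero    x a b = refl
prod0-^-+ (suc m) x a b = begin
  (x 0 ^ a 0 * P a) * (x 0 ^ b 0 * P b) ≡⟨ interchange (x 0 ^ a 0) (x 0 ^ b 0) (P a) (P b) ⟩
  (x 0 ^ a 0 * x 0 ^ b 0) * (P a * P b) ≡⟨ cong₂ _*_ (sym (^-distribˡ-+-* (x 0) (a 0) (b 0))) (prod0-^-+ m (x ∘ suc) (a ∘ suc) (b ∘ suc)) ⟩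
  x 0 ^ (a 0 + b 0) * prod0 m (λ k → x (suc k) ^ (a (suc k) + b (suc k))) ∎
  where
  open ≡-Reasoning
  P : (ℕ → ℕ) → ℕ
  P e = prod0 m (λ k → x (suc k) ^ e (suc k))
  interchange : ∀ a b p q → (a * p) * (b * q) ≡ (a * b) * (p * q)
  interchange = solve-∀

prod1-prod0 : ∀ t f → prod1 t f ≡ prod0 t (f ∘ suc)
prod1-prod0 zero    f = refl
prod1-prod0 (suc t) f = trans (cong (_* f (suc t)) (prod1-prod0 t f)) (sym (prod0-snoc t (f ∘ suc)))

-- Doubling is written d * 2 so that suc d * 2 ∸ 2 reduces to d * 2.
aExponent : ℕ → ℕ → ℕ
aExponent m k = 2 ^ ((m ∸ k) * 2 ∸ 1)

bExponent : ℕ → ℕ → ℕ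
bExponent m k = 2 ^ ((m ∸ k) * 2 ∸ 2)

aFactor-even : ∀ m f → aFactor (m * 2) f ≡ prod0 m (λ k → f k ^ aExponent m k) * f m
aFactor-even zero    f = sym (*-identityˡ (f 0))
aFactor-even (suc m) f = trans (cong (f 0 ^ aExponent (suc m) 0 *_) (aFactor-even m (f ∘ suc)))
                               (sym (*-assoc (f 0 ^ aExponent (suc m) 0) _ _))

bFactor-even : ∀ m f → bFactor (m * 2) f ≡ prod0 m (λ k → f (suc k) ^ bExponent m k) * f m
bFactor-even zero    f = sym (*-identityˡ (f 0))
bFactor-even (suc m) f = trans (cong (f 1 ^ bExponent (suc m) 0 *_) (bFactor-even m (f ∘ suc)))
                               (sym (*-assoc (f 1 ^ bExponent (suc m) 0) _ _))

2^x+2^[1+x] : ∀ x → 2 ^ x + 2 ^ suc x ≡ 3 * 2 ^ x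
2^x+2^[1+x] x = triple (2 ^ x)
  where
  triple : ∀ y → y + 2 * y ≡ 3 * y
  triple = solve-∀

double-∸ : ∀ t k → 2 * suc t ∸ 2 * suc k ≡ (t ∸ k) * 2
double-∸ t k = trans (sym (*-distribˡ-∸ 2 (suc t) (suc k))) (*-comm 2 (t ∸ k))

suc-∸ : ∀ {t k} → k ≤ t → suc t ∸ k ≡ suc (t ∸ k)
suc-∸ = +-∸-assoc 1

even-exponent : ∀ t {k} → k < t → aExponent (suc t) (suc k) + bExponent (suc t) k ≡ 3 * 2 ^ (2 * suc t ∸ 2 * suc k ∸ 1)
even-exponent t {k} k<t rewrite double-∸ t k | suc-∸ (<⇒≤ k<t) | suc-∸ {t} {suc k} k<t = 2^x+2^[1+x] (suc ((t ∸ suc k) * 2))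

odd-exponent : ∀ t {k} → k ≤ t → bExponent (suc t) k + aExponent (suc t) k ≡ 3 * 2 ^ (2 * suc t + 1 ∸ 2 * suc k ∸ 1)
odd-exponent t {k} k≤t rewrite +-∸-comm 1 (*-monoʳ-≤ 2 (s≤s k≤t)) | m+n∸n≡m (2 * suc t ∸ 2 * suc k) 1 | double-∸ t k | suc-∸ k≤t
  = 2^x+2^[1+x] ((t ∸ k) * 2)

forests-even : ∀ m → aFactor (2 * m) M * bFactor (2 * m) M ≡ M m ^ 3 * prod1 (m ∸ 1) (λ i → M i ^ (3 * 2 ^ (2 * m ∸ 2 * i ∸ 1)))
forests-even zero    = refl
forests-even (suc t) = begin
  aFactor (2 * m) M * bFactor (2 * m) M
    ≡⟨ cong (λ n → aFactor n M * bFactor n M) (*-comm 2 m) ⟩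
  aFactor (m * 2) M * bFactor (m * 2) M
    ≡⟨ cong₂ _*_ (aFactor-even m M) (bFactor-even m M) ⟩
  (prod0 m (λ k → M k ^ aExponent m k) * M m) * (prod0 m (λ k → M (suc k) ^ bExponent m k) * M m)
    ≡⟨ cong₂ (λ a b → (a * M m) * (b * M m)) (cong (_* A) (^-zeroˡ (aExponent m 0)))
                                             (trans (prod0-snoc t _) (cong (λ e → B * M m ^ e) last-b)) ⟩
  ((1 * A) * M m) * ((B * M m ^ 1) * M m)
    ≡⟨ regroup (M m) A B ⟩
  M m ^ 3 * (A * B)
    ≡⟨ cong (M m ^ 3 *_) (prod0-^-+ t (M ∘ suc) (aExponent m ∘ suc) (bExponent m)) ⟩
  M m ^ 3 * prod0 t (λ k → M (suc k) ^ (aExponent m (suc k) + bExponent m k))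
    ≡⟨ cong (M m ^ 3 *_) (prod0-cong t (λ {k} k<t → cong (M (suc k) ^_) (even-exponent t k<t))) ⟩
  M m ^ 3 * prod0 t (λ k → M (suc k) ^ (3 * 2 ^ (2 * m ∸ 2 * suc k ∸ 1)))
    ≡⟨ cong (M m ^ 3 *_) (prod1-prod0 t _) ⟨
  M m ^ 3 * prod1 t (λ i → M i ^ (3 * 2 ^ (2 * m ∸ 2 * i ∸ 1))) ∎
  where
  open ≡-Reasoning
  m : ℕ
  m = suc t
  A B : ℕ
  A = prod0 t (λ k → M (suc k) ^ aExponent m (suc k))
  B = prod0 t (λ k → M (suc k) ^ bExponent m k)
  last-b : bExponent m t ≡ 1
  last-b = cong (λ d → 2 ^ (d * 2 ∸ 2)) (m+n∸n≡m 1 t)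
  regroup : ∀ x a b → ((1 * a) * x) * ((b * (x * 1)) * x) ≡ (x * (x * (x * 1))) * (a * b)
  regroup = solve-∀

forests-odd : ∀ m → aFactor (2 * m + 1) M * bFactor (2 * m + 1) M
                    ≡ M m ^ 4 * M (m + 1) * prod1 (m ∸ 1) (λ i → M i ^ (3 * 2 ^ (2 * m + 1 ∸ 2 * i ∸ 1)))
forests-odd zero    = refl
forests-odd (suc t) = begin
  aFactor (2 * m + 1) M * bFactor (2 * m + 1) M
    ≡⟨ cong (λ n → aFactor n M * bFactor n M) (trans (+-comm (2 * m) 1) (cong suc (*-comm 2 m))) ⟩
  (M 0 ^ 2 ^ (m * 2) * bFactor (m * 2) M) * aFactor (m * 2) (M ∘ suc)
    ≡⟨ cong₂ (λ b a → (M 0 ^ 2 ^ (m * 2) * b) * a) (bFactor-even m M) (aFactor-even m (M ∘ suc)) ⟩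
  (M 0 ^ 2 ^ (m * 2) * (prod0 m (λ k → M (suc k) ^ bExponent m k) * M m)) * (prod0 m (λ k → M (suc k) ^ aExponent m k) * M (suc m))
    ≡⟨ cong₂ (λ b a → (M 0 ^ 2 ^ (m * 2) * (b * M m)) * (a * M (suc m)))
             (trans (prod0-snoc t _) (cong (λ e → B * M m ^ e) last-b))
             (trans (prod0-snoc t _) (cong (λ e → A * M m ^ e) last-a)) ⟩
  (M 0 ^ 2 ^ (m * 2) * ((B * M m ^ 1) * M m)) * ((A * M m ^ 2) * M (suc m))
    ≡⟨ cong (λ u → (u * ((B * M m ^ 1) * M m)) * ((A * M m ^ 2) * M (suc m))) (^-zeroˡ (2 ^ (m * 2))) ⟩
  (1 * ((B * M m ^ 1) * M m)) * ((A * M m ^ 2) * M (suc m))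
    ≡⟨ regroup (M m) (M (suc m)) B A ⟩
  M m ^ 4 * M (suc m) * (B * A)
    ≡⟨ cong₂ (λ j p → M m ^ 4 * M j * p) (+-comm 1 m) (prod0-^-+ t (M ∘ suc) (bExponent m) (aExponent m)) ⟩
  M m ^ 4 * M (m + 1) * prod0 t (λ k → M (suc k) ^ (bExponent m k + aExponent m k))
    ≡⟨ cong (M m ^ 4 * M (m + 1) *_) (prod0-cong t (λ {k} k<t → cong (M (suc k) ^_) (odd-exponent t (<⇒≤ k<t)))) ⟩
  M m ^ 4 * M (m + 1) * prod0 t (λ k → M (suc k) ^ (3 * 2 ^ (2 * m + 1 ∸ 2 * suc k ∸ 1)))
    ≡⟨ cong (M m ^ 4 * M (m + 1) *_) (prod1-prod0 t _) ⟨
  M m ^ 4 * M (m + 1) * prod1 t (λ i → M i ^ (3 * 2 ^ (2 * m + 1 ∸ 2 * i ∸ 1))) ∎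
  where
  open ≡-Reasoning
  m : ℕ
  m = suc t
  A B : ℕ
  A = prod0 t (λ k → M (suc k) ^ aExponent m k)
  B = prod0 t (λ k → M (suc k) ^ bExponent m k)
  last-a : aExponent m t ≡ 2
  last-a = cong (λ d → 2 ^ (d * 2 ∸ 1)) (m+n∸n≡m 1 t)
  last-b : bExponent m t ≡ 1
  last-b = cong (λ d → 2 ^ (d * 2 ∸ 2)) (m+n∸n≡m 1 t)
  regroup : ∀ x y b a → (1 * ((b * (x * 1)) * x)) * ((a * (x * (x * 1))) * y) ≡ (x * (x * (x * (x * 1)))) * y * (b * a)
  regroup = solve-∀

mainTheorem13 :
    (∀ n m → n ≡ 2 * m + 1 →
      NumSpanningForests n
        (M m ^ 4 * M (m + 1) * prod1 (m ∸ 1) (λ i → M i ^ (3 * 2 ^ (n ∸ 2 * i ∸ 1))))) ×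
    (∀ n m → 1 ≤ n → n ≡ 2 * m →
      NumSpanningForests n
        (M m ^ 3 * prod1 (m ∸ 1) (λ i → M i ^ (3 * 2 ^ (n ∸ 2 * i ∸ 1))))) ×
    NumSpanningForests 1 3 ×
    NumSpanningForests 2 (3 ^ 3) ×
    NumSpanningForests 3 (3 ^ 5 * 5)
mainTheorem13 = odd , even , numSpanningForests 1 , numSpanningForests 2 , numSpanningForests 3
  where
  odd : ∀ n m → n ≡ 2 * m + 1 →
        NumSpanningForests n (M m ^ 4 * M (m + 1) * prod1 (m ∸ 1) (λ i → M i ^ (3 * 2 ^ (n ∸ 2 * i ∸ 1))))
  odd _ m refl = subst (NumSpanningForests (2 * m + 1)) (forests-odd m) (numSpanningForests (2 * m + 1))
  -- The count is also correct for n = 0.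
  even : ∀ n m → 1 ≤ n → n ≡ 2 * m →
         NumSpanningForests n (M m ^ 3 * prod1 (m ∸ 1) (λ i → M i ^ (3 * 2 ^ (n ∸ 2 * i ∸ 1))))
  even _ m _ refl = subst (NumSpanningForests (2 * m)) (forests-even m) (numSpanningForests (2 * m))
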